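{- For any category of FH models $\mathcal{C}(\mathsf{K}_{\mathsf{At}})$, its $T$-transform $T(\mathcal{C}(\mathsf{K}_{\mathsf{At}}))$ is an implicit knowledge-based HMS model.
   Context: Fix non-empty sets $\mathsf{At}$ (atoms) and $I$ (individuals). Language $\mathcal{L}_{\mathsf{At}}$: $\varphi::=\top\mid p\mid\neg\varphi\mid\varphi\wedge\psi\mid\ell_i\varphi\mid a_i\varphi\mid k_i\varphi$; $\mathsf{At}(\varphi)$ = atoms in $\varphi$, $\mathsf{At}(A)=\bigcup_{\varphi\in A}\mathsf{At}(\varphi)$; $\mathcal{L}_\Phi=\{\varphi:\mathsf{At}(\varphi)\subseteq\Phi\}$. FH model for $\Phi$: $\mathsf{K}_\Phi=\langle I,W_\Phi,(R_{\Phi,i}),(\mathcal{A}_{\Phi,i}),V_\Phi\rangle$, $W_\Phi\ne\emptyset$, $R_{\Phi,i}$ equivalence relations, $\mathcal{A}_{\Phi,i}:W_\Phi\to2^{\mathcal{L}_\Phi}$ with $\varphi\in\mathcal{A}_{\Phi,i}(w)$ iff all $p\in\mathsf{At}(\varphi)$ are in $\mathcal{A}_{\Phi,i}(w)$, and $(w,t)\in R_{\Phi,i}\Rightarrow\mathcal{A}_{\Phi,i}(w)=\mathcal{A}_{\Phi,i}(t)$; $V_\Phi:\Phi\to2^{W_\Phi}$. Surjective bounded morphism $f^\Phi_\Psi$ ($\Psi\subseteq\Phi$): surjection $W_\Phi\to W_\Psi$ with $w\in V_\Phi(p)\iff f^\Phi_\Psi(w)\in V_\Psi(p)$ for $p\in\Psi$;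 $\mathcal{A}_{\Phi,i}(w)\cap\mathcal{L}_\Psi=\mathcal{A}_{\Psi,i}(f^\Phi_\Psi(w))$; $(w,t)\in R_{\Phi,i}\Rightarrow(f^\Phi_\Psi(w),f^\Phi_\Psi(t))\in R_{\Psi,i}$; if $(f^\Phi_\Psi(w),t')\in R_{\Psi,i}$ there is $t$ with $f^\Phi_\Psi(t)=t'$, $(w,t)\in R_{\Phi,i}$. A category of FH models $\mathcal{C}(\mathsf{K}_{\mathsf{At}})$: one FH model $\mathsf{K}_\Phi$ per $\Phi\subseteq\mathsf{At}$, one surjective bounded morphism $f^\Phi_\Psi$ per $\Psi\subseteq\Phi$, $f^\Phi_\Phi=\mathrm{id}$, $f^\Phi_\Upsilon=f^\Psi_\Upsilon\circ f^\Phi_\Psi$. $T$-transform: $S_\Phi:=W_\Phi$, $\Omega:=\bigcup_\Phi S_\Phi$, $r^\Phi_\Psi:=f^\Phi_\Psi$; for $w\in S_\Phi$, $\Lambda^*_i(w):=\{w':(w,w')\in R_{\Phi,i}\}$; for $w\in S_\Psi$, $\alpha_i(w):=S_\Upsilon$ with $\Upsilon=\mathsf{At}(\mathcal{A}_{\Psi,i}(w))$; $v(p):=\bigcup_{\Phi\ni p}V_\Phi(p)$. Implicit knowledge-based HMS model $\langle I,\{S_\Phi\},(r^\Phi_\Psi),(\Lambda^*_i),(\alpha_i),v\rangle$: non-empty pairwise disjoint spaces $S_\Phi$ ordered $S_{\Phi'}\succeq S_\Phi$ iff $\Phi\subseteq\Phi'$; surjections $r^\Phi_\Psi$ with $r^\Phi_\Phi=\mathrm{id}$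 and $r^\Phi_\Upsilon=r^\Psi_\Upsilon\circ r^\Phi_\Psi$; notation $\omega_\Psi=r^\Phi_\Psi(\omega)$, $D_\Psi=r^\Phi_\Psi(D)$, $D^\uparrow=\bigcup_{\Phi\subseteq\Psi}(r^\Psi_\Phi)^{ -1}(D)$ for $D\subseteq S_\Phi$; events are sets $D^\uparrow$; $v$ maps each atom to an event; $\Lambda^*_i:\Omega\to2^\Omega\setminus\{\emptyset\}$ with Reflexivity, Stationarity ($\omega'\in\Lambda^*_i(\omega)\Rightarrow\Lambda^*_i(\omega')=\Lambda^*_i(\omega)$), Projections Preserve Implicit Knowledge ($\omega\in S_\Phi$, $\Psi\subseteq\Phi\Rightarrow\Lambda^*_i(\omega)_\Psi=\Lambda^*_i(\omega_\Psi)$); $\alpha_i:\Omega\to\{S_\Phi\}$ with (O) $\omega\in S_\Phi\Rightarrow\alpha_i(\omega)\preceq S_\Phi$; (I) $\omega'\in\Lambda^*_i(\omega)\Rightarrow\alpha_i(\omega')=\alpha_i(\omega)$; (II) $\omega\in S_\Phi$, $S_\Psi\preceq\alpha_i(\omega)\Rightarrow\alpha_i(\omega_\Psi)=S_\Psi$; (III) $\omega\in S_\Phi$, $\alpha_i(\omega)\preceq S_\Psi\preceq S_\Phi\Rightarrow\alpha_i(\omega_\Psi)=\alpha_i(\omega)$; (IV) $\omega\in S_\Phi$, $\Psi\subseteq\Phi\Rightarrow\alpha_i(\omega)\succeq\alpha_i(\omega_\Psi)$. -}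

module Defs where

open import Level using (0ℓ)
open import Data.Empty using (⊥)
open import Data.Product using (Σ; _×_; _,_; ∃)
open import Data.Sum using (_⊎_)
open import Relation.Binary.PropositionalEquality using (_≡_)
open import Relation.Binary.Structures using (IsEquivalence)

module FH (At I : Set) where

  data Form : Set where
    ⊤'   : Form
    atom : At → Form
    ¬'_  : Form → Form
    _∧'_ : Form → Form → Form
    ℓ    : I → Form → Form
    a    : I → Form → Form
    k    : I → Form → Form

  _∈At_ : At → Form → Set
  p ∈At ⊤'       = ⊥
  p ∈At atom q   = p ≡ q
  p ∈At (¬' φ)   = p ∈At φ
  p ∈At (φ ∧' ψ) = p ∈At φ ⊎ p ∈At ψ
  p ∈At ℓ _ φ    = p ∈At φ
  p ∈At a _ φ    = p ∈At φ
  p ∈At k _ φ    = p ∈At φ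

  Subset : Set₁
  Subset = At → Set

  _⊆_ : Subset → Subset → Set
  Φ ⊆ Ψ = ∀ p → Φ p → Ψ p

  _≐_ : Subset → Subset → Set
  Φ ≐ Ψ = (Φ ⊆ Ψ) × (Ψ ⊆ Φ)

  InL : Subset → Form → Set
  InL Φ φ = ∀ p → p ∈At φ → Φ p

  _≐ₛ_ : {X : Set} → (X → Set) → (X → Set) → Set
  _≐ₛ_ {X} D E = ∀ x → (D x → E x) × (E x → D x)

  record FHModel (Φ : Subset) : Set₁ where
    field
      W        : Set
      w₀       : W
      R        : I → W → W → Set
      R-equiv  : ∀ i → IsEquivalence (R i)
      A        : I → W → Form → Set
      A-inL    : ∀ i w φ → A i w φ → InL Φ φ
      A-atoms  : ∀ i w φ → InL Φ φ →
                 (A i w φ → ∀ p → p ∈At φ → A i w (atom p)) ×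
                 ((∀ p → p ∈At φ → A i w (atom p)) → A i w φ)
      A-R      : ∀ i w t → R i w t → ∀ φ → (A i w φ → A i t φ) × (A i t φ → A i w φ)
      V        : (p : At) → .(Φ p) → W → Set

  open FHModel public

  record IsSBM {Φ Ψ : Subset} (KΦ : FHModel Φ) (KΨ : FHModel Ψ)
               (f : W KΦ → W KΨ) : Set₁ where
    field
      surj   : ∀ y → ∃ λ x → f x ≡ y
      val    : ∀ p (hΦ : Φ p) (hΨ : Ψ p) w →
               (V KΦ p hΦ w → V KΨ p hΨ (f w)) × (V KΨ p hΨ (f w) → V KΦ p hΦ w)
      aware  : ∀ i w φ → ((A KΦ i w φ × InL Ψ φ) → A KΨ i (f w) φ) ×
                         (A KΨ i (f w) φ → A KΦ i w φ × InL Ψ φ)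
      forth  : ∀ i w t → R KΦ i w t → R KΨ i (f w) (f t)
      back   : ∀ i w t' → R KΨ i (f w) t' → ∃ λ t → (f t ≡ t') × R KΦ i w t

  record FHCategory : Set₁ where
    field
      K     : (Φ : Subset) → FHModel Φ
      f     : ∀ Φ Ψ → .(Ψ ⊆ Φ) → W (K Φ) → W (K Ψ)
      f-sbm : ∀ Φ Ψ (h : Ψ ⊆ Φ) → IsSBM (K Φ) (K Ψ) (f Φ Ψ h)
      f-id  : ∀ Φ (h : Φ ⊆ Φ) w → f Φ Φ h w ≡ w
      f-comp : ∀ Φ Ψ Υ (h₁ : Ψ ⊆ Φ) (h₂ : Υ ⊆ Ψ) (h₃ : Υ ⊆ Φ) w →
               f Φ Υ h₃ w ≡ f Ψ Υ h₂ (f Φ Ψ h₁ w)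

  -- HMS model data: spaces S_Φ indexed by Φ ⊆ At (so they are pairwise
  -- disjoint in Ω = Σ Φ, S_Φ, and ordered by inclusion of indices)
  record HMSData : Set₂ where
    field
      S  : Subset → Set
      r  : ∀ Φ Ψ → .(Ψ ⊆ Φ) → S Φ → S Ψ
      Λ  : I → ∀ Φ → S Φ → (S Φ → Set)
      α  : I → ∀ Φ → S Φ → Subset               -- α_i(ω) = S_{α i Φ ω}
      v  : At → (Σ Subset S → Set)

  module _ (M : HMSData) where
    open HMSData M

    Ω : Set₁
    Ω = Σ Subset S

    image : ∀ Φ Ψ → (Ψ ⊆ Φ) → (S Φ → Set) → (S Ψ → Set)
    image Φ Ψ h D y = ∃ λ x → D x × (r Φ Ψ h x ≡ y)

    up : ∀ Φ → (S Φ → Set) → (Ω → Set)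
    up Φ D (Ψ , x) = Σ (Φ ⊆ Ψ) λ h → D (r Ψ Φ h x)

    IsEvent : (Ω → Set) → Set₁
    IsEvent E = Σ Subset λ Φ → Σ (S Φ → Set) λ D →
                ∀ ω → (E ω → up Φ D ω) × (up Φ D ω → E ω)

    record IsImplicitHMS : Set₁ where
      field
        nonempty  : ∀ Φ → S Φ
        r-surj    : ∀ Φ Ψ (h : Ψ ⊆ Φ) y → ∃ λ x → r Φ Ψ h x ≡ y
        r-id      : ∀ Φ (h : Φ ⊆ Φ) x → r Φ Φ h x ≡ x
        r-comp    : ∀ Φ Ψ Υ (h₁ : Ψ ⊆ Φ) (h₂ : Υ ⊆ Ψ) (h₃ : Υ ⊆ Φ) x →
                    r Φ Υ h₃ x ≡ r Ψ Υ h₂ (r Φ Ψ h₁ x)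
        v-event   : ∀ p → IsEvent (v p)
        Λ-nonempty : ∀ i Φ ω → ∃ λ ω' → Λ i Φ ω ω'
        reflexivity : ∀ i Φ ω → Λ i Φ ω ω
        stationarity : ∀ i Φ ω ω' → Λ i Φ ω ω' → Λ i Φ ω' ≐ₛ Λ i Φ ω
        ppik      : ∀ i Φ Ψ (h : Ψ ⊆ Φ) ω →
                    image Φ Ψ h (Λ i Φ ω) ≐ₛ Λ i Ψ (r Φ Ψ h ω)
        α-O       : ∀ i Φ ω → α i Φ ω ⊆ Φ
        α-I       : ∀ i Φ ω ω' → Λ i Φ ω ω' → α i Φ ω' ≐ α i Φ ω
        α-II      : ∀ i Φ Ψ (h : Ψ ⊆ Φ) ω → Ψ ⊆ α i Φ ω →
                    α i Ψ (r Φ Ψ h ω) ≐ Ψ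
        α-III     : ∀ i Φ Ψ (h : Ψ ⊆ Φ) ω → α i Φ ω ⊆ Ψ →
                    α i Ψ (r Φ Ψ h ω) ≐ α i Φ ω
        α-IV      : ∀ i Φ Ψ (h : Ψ ⊆ Φ) ω → α i Ψ (r Φ Ψ h ω) ⊆ α i Φ ω

  T : FHCategory → HMSData
  T C = record
    { S = λ Φ → W (K Φ)
    ; r = f
    ; Λ = λ i Φ w w' → R (K Φ) i w w'
    ; α = λ i Φ w p → Σ Form λ φ → A (K Φ) i w φ × (p ∈At φ)
    ; v = λ p ω → Σ (Data.Product.proj₁ ω p) λ h → V (K (Data.Product.proj₁ ω)) p h (Data.Product.proj₂ ω)
    }
    where open FHCategory C

-- Each axiom of the HMS model is the image of one clause of the FH models or
-- their morphisms: Λ* is an equivalence class of R, so reflexivity and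
-- stationarity hold, and the forth/back conditions say exactly that the
-- morphisms map classes onto classes.  α_i(w) is indexed by the atoms of
-- A_i(w), and since an FH awareness set is generated by its atoms, p lies in
-- that index iff atom p ∈ A_i(w); conditions (O)-(IV) then follow from
-- A_i(w) ⊆ L_Φ, the invariance of A_i along R and the awareness clause of the
-- morphisms.  Finally v(p) is the upward closure of V_{p}(p).
module Submission where

open import Defs
open import Data.Product using (Σ; _×_; _,_; proj₁; proj₂)
open import Relation.Binary.PropositionalEquality using (_≡_; refl)
open import Relation.Binary.Structures using (IsEquivalence)
open import Relation.Unary using (｛_｝)

module _ (At I : Set) where
  open FH At I

  equivalence-class-≐ : {X : Set} {_∼_ : X → X → Set} → IsEquivalence _∼_ →
                        ∀ {x y} → x ∼ y → (y ∼_) ≐ₛ (x ∼_)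
  equivalence-class-≐ isEq x∼y z =
    (λ y∼z → trans x∼y y∼z) , (λ x∼z → trans (sym x∼y) x∼z)
    where open IsEquivalence isEq

  singleton-⊆ : ∀ {p} {Ψ : Subset} → Ψ p → ｛ p ｝ ⊆ Ψ
  singleton-⊆ Ψp _ refl = Ψp

  atom-inL : ∀ {p} {Ψ : Subset} → Ψ p → InL Ψ (atom p)
  atom-inL Ψp _ refl = Ψp

  module _ {Φ : Subset} (K : FHModel Φ) where

    awarenessAtoms : I → W K → Subset
    awarenessAtoms i w p = Σ Form λ φ → A K i w φ × p ∈At φ

    aware-atom⇒awarenessAtoms : ∀ {i w p} → A K i w (atom p) → awarenessAtoms i w p
    aware-atom⇒awarenessAtoms aφ = atom _ , aφ , refl

    awarenessAtoms⇒aware-atom : ∀ {i w p} → awarenessAtoms i w p → A K i w (atom p)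
    awarenessAtoms⇒aware-atom {i} {w} (φ , aφ , p∈φ) =
      proj₁ (A-atoms K i w φ (A-inL K i w φ aφ)) aφ _ p∈φ

    awarenessAtoms-⊆ : ∀ i w → awarenessAtoms i w ⊆ Φ
    awarenessAtoms-⊆ i w p (φ , aφ , p∈φ) = A-inL K i w φ aφ p p∈φ

    awarenessAtoms-R : ∀ {i w t} → R K i w t → awarenessAtoms i t ≐ awarenessAtoms i w
    awarenessAtoms-R {i} {w} {t} wRt =
      (λ _ (φ , aφ , p∈φ) → φ , proj₂ (A-R K i w t wRt φ) aφ , p∈φ) ,
      (λ _ (φ , aφ , p∈φ) → φ , proj₁ (A-R K i w t wRt φ) aφ , p∈φ)

  module _ {Φ Ψ : Subset} {KΦ : FHModel Φ} {KΨ : FHModel Ψ} {g : W KΦ → W KΨ}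
           (sbm : IsSBM KΦ KΨ g) where
    open IsSBM sbm

    image-R-class : ∀ i w →
      (λ t' → Σ (W KΦ) λ t → R KΦ i w t × g t ≡ t') ≐ₛ R KΨ i (g w)
    image-R-class i w t' =
      (λ { (t , wRt , refl) → forth i w t wRt }) ,
      (λ gwRt' → let (t , gt≡t' , wRt) = back i w t' gwRt' in t , wRt , gt≡t')

    awarenessAtoms-image-⊆ : ∀ i w → awarenessAtoms KΨ i (g w) ⊆ awarenessAtoms KΦ i w
    awarenessAtoms-image-⊆ i w _ (φ , aφ , p∈φ) =
      φ , proj₁ (proj₂ (aware i w φ) aφ) , p∈φ

    awarenessAtoms-image-⊇ : ∀ i w {p} → Ψ p →
      awarenessAtoms KΦ i w p → awarenessAtoms KΨ i (g w) p
    awarenessAtoms-image-⊇ i w Ψp p∈αw =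
      aware-atom⇒awarenessAtoms KΨ
        (proj₁ (aware i w (atom _)) (awarenessAtoms⇒aware-atom KΦ p∈αw , atom-inL Ψp))

    awarenessAtoms-image-≐-target : ∀ i w → Ψ ⊆ awarenessAtoms KΦ i w →
      awarenessAtoms KΨ i (g w) ≐ Ψ
    awarenessAtoms-image-≐-target i w Ψ⊆αw =
      awarenessAtoms-⊆ KΨ i (g w) ,
      λ p Ψp → awarenessAtoms-image-⊇ i w Ψp (Ψ⊆αw p Ψp)

    awarenessAtoms-image-≐-source : ∀ i w → awarenessAtoms KΦ i w ⊆ Ψ →
      awarenessAtoms KΨ i (g w) ≐ awarenessAtoms KΦ i w
    awarenessAtoms-image-≐-source i w αw⊆Ψ =
      awarenessAtoms-image-⊆ i w ,
      λ p p∈αw → awarenessAtoms-image-⊇ i w (αw⊆Ψ p p∈αw) p∈αw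

  module _ (C : FHCategory) where
    open FHCategory C

    valuation-event : ∀ p → IsEvent (T C) (HMSData.v (T C) p)
    valuation-event p = ｛ p ｝ , V (K ｛ p ｝) p refl , λ where
      (Ψ , w) →
        (λ (Ψp , Vw) → singleton-⊆ Ψp ,
            proj₁ (IsSBM.val (f-sbm Ψ ｛ p ｝ (singleton-⊆ Ψp)) p Ψp refl w) Vw) ,
        (λ (p⊆Ψ , Vfw) → p⊆Ψ p refl ,
            proj₂ (IsSBM.val (f-sbm Ψ ｛ p ｝ p⊆Ψ) p (p⊆Ψ p refl) refl w) Vfw)

proposition7 : (At I : Set) → At → I → (C : FH.FHCategory At I) →
    FH.IsImplicitHMS At I (FH.T At I C)
proposition7 At I _ _ C = record
  { nonempty     = λ Φ → w₀ (K Φ)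
  ; r-surj       = λ Φ Ψ h → IsSBM.surj (f-sbm Φ Ψ h)
  ; r-id         = f-id
  ; r-comp       = f-comp
  ; v-event      = valuation-event At I C
  ; Λ-nonempty   = λ i Φ w → w , R-refl Φ i
  ; reflexivity  = λ i Φ w → R-refl Φ i
  ; stationarity = λ i Φ w w' → equivalence-class-≐ At I (R-equiv (K Φ) i)
  ; ppik         = λ i Φ Ψ h → image-R-class At I (f-sbm Φ Ψ h) i
  ; α-O          = λ i Φ → awarenessAtoms-⊆ At I (K Φ) i
  ; α-I          = λ i Φ w w' → awarenessAtoms-R At I (K Φ)
  ; α-II         = λ i Φ Ψ h → awarenessAtoms-image-≐-target At I (f-sbm Φ Ψ h) i
  ; α-III        = λ i Φ Ψ h → awarenessAtoms-image-≐-source At I (f-sbm Φ Ψ h) i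
  ; α-IV         = λ i Φ Ψ h → awarenessAtoms-image-⊆ At I (f-sbm Φ Ψ h) i
  }
  where
  open FH At I
  open FHCategory C
  R-refl : ∀ Φ i {w} → R (K Φ) i w w
  R-refl Φ i = IsEquivalence.refl (R-equiv (K Φ) i)
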